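{- Let $M=M(S_0,\dots,S_r)$ be the freedom matroid of a flag on $S$. If $F$ is any flat of rank $k$ in $M$, then $|F|\le|S_k|$.
   Context: A flag on a finite set $S$ is a sequence $(S_0,\dots,S_r)$ with $S_r=S$ and $S_{i-1}\subsetneq S_i$ for $1\le i\le r$. The freedom matroid $M(S_0,\dots,S_r)$ is the matroid on $S$ whose independent sets are the $I\subseteq S$ with $|I\cap S_i|\le i$ for all $i$. -}

module Defs where

open import Data.Nat using (ℕ; suc; _≤_)
open import Data.Fin using (Fin; fromℕ; inject₁; toℕ)
open import Data.Fin.Subset using (Subset; ⊤; ⁅_⁆; _∈_; _∉_; _⊆_; _⊂_; _∩_; _∪_; ∣_∣)
open import Data.Product using (∃; _×_)
open import Relation.Binary.PropositionalEquality using (_≡_)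
open import Relation.Nullary using (¬_)

record Flag (n : ℕ) : Set where
  field
    r      : ℕ
    S      : Fin (suc r) → Subset n
    top    : S (fromℕ r) ≡ ⊤
    strict : (i : Fin r) → S (inject₁ i) ⊂ S (Data.Fin.suc i)

module _ {n : ℕ} (fl : Flag n) where
  open Flag fl

  Independent : Subset n → Set
  Independent I = (i : Fin (suc r)) → ∣ I ∩ S i ∣ ≤ toℕ i

  HasRank : Subset n → ℕ → Set
  HasRank X k =
    (∃ λ I → I ⊆ X × Independent I × ∣ I ∣ ≡ k)
    × ((J : Subset n) → J ⊆ X → Independent J → ∣ J ∣ ≤ k)

  IsFlat : Subset n → Set
  IsFlat F = (e : Fin n) → e ∉ F → (k : ℕ) → HasRank F k → ¬ HasRank (F ∪ ⁅ e ⁆) k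

-- Let I be a maximum independent subset of F and S_j the largest member of the flag on which I is
-- tight, |I ∩ S_j| = j. Every x ∈ F outside S_j can be added to I without violating any constraint
-- (those up to j do not see x, those above j are slack), so by maximality x ∈ I; thus F ⊆ I ∪ S_j.
-- Hence |F| ≤ |S_j| + |I| − j = |S_j| + (k − j) ≤ |S_k|, as each step of the flag adds an element.
module Submission where

open import Defs
open import Data.Nat using (ℕ; zero; suc; _+_; _∸_; _≤_; _<_; _≤?_; s<s⁻¹)
open import Data.Nat.Properties
  using (+-suc; +-comm; +-assoc; +-identityʳ; +-monoˡ-≤; +-monoʳ-≤; +-cancelʳ-≤; ≤-trans;
         ≤-reflexive; <⇒≱; <⇒≢; ≰⇒>; ≤∧≢⇒<; n≤0⇒n≡0; m+[n∸m]≡n; m≤m+n)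
  renaming (_≟_ to _≟ℕ_)
open import Data.Fin as Fin using (Fin; toℕ; fromℕ<; lower₁)
open import Data.Fin.Properties using (any?; toℕ-injective; toℕ-fromℕ<; toℕ-lower₁; inject₁-lower₁; toℕ≤pred[n])
open import Data.Fin.Subset using (Subset; inside; outside; _∈_; _∉_; _⊆_; _⊂_; _∩_; _∪_; ⁅_⁆; ∣_∣)
open import Data.Fin.Subset.Properties
  using (_∈?_; p⊆q⇒∣p∣≤∣q∣; p⊂q⇒∣p∣<∣q∣; ⊆-trans; p⊆p∪q; q⊆p∪q; x∈p∪q⁻; x∈p∩q⁺; x∈p∩q⁻;
         x∈⁅x⁆; x∈⁅y⁆⇒x≡y; ∣⁅x⁆∣≡1; ∣p∩q∣≤∣p∣; ∩-distribʳ-∪)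
open import Data.Vec using (_∷_; [])
open import Data.Product using (∃; _×_; _,_; proj₁; proj₂)
open import Data.Sum using (inj₁; inj₂)
open import Function using (_∘_)
open import Relation.Nullary using (¬_; yes; no; contradiction)
open import Relation.Unary using (Pred; Decidable)
open import Relation.Binary.PropositionalEquality using (_≡_; _≢_; refl; sym; trans; cong; subst; subst₂)

∣p∪q∣+∣p∩q∣≡∣p∣+∣q∣ : ∀ {n} (p q : Subset n) → ∣ p ∪ q ∣ + ∣ p ∩ q ∣ ≡ ∣ p ∣ + ∣ q ∣
∣p∪q∣+∣p∩q∣≡∣p∣+∣q∣ []            []            = refl
∣p∪q∣+∣p∩q∣≡∣p∣+∣q∣ (inside  ∷ p) (inside  ∷ q) =
  cong suc (trans (+-suc _ _) (trans (cong suc (∣p∪q∣+∣p∩q∣≡∣p∣+∣q∣ p q)) (sym (+-suc _ _))))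
∣p∪q∣+∣p∩q∣≡∣p∣+∣q∣ (inside  ∷ p) (outside ∷ q) = cong suc (∣p∪q∣+∣p∩q∣≡∣p∣+∣q∣ p q)
∣p∪q∣+∣p∩q∣≡∣p∣+∣q∣ (outside ∷ p) (inside  ∷ q) =
  trans (cong suc (∣p∪q∣+∣p∩q∣≡∣p∣+∣q∣ p q)) (sym (+-suc _ _))
∣p∪q∣+∣p∩q∣≡∣p∣+∣q∣ (outside ∷ p) (outside ∷ q) = ∣p∪q∣+∣p∩q∣≡∣p∣+∣q∣ p q

∣p∪q∣≤∣p∣+∣q∣ : ∀ {n} (p q : Subset n) → ∣ p ∪ q ∣ ≤ ∣ p ∣ + ∣ q ∣
∣p∪q∣≤∣p∣+∣q∣ p q = ≤-trans (m≤m+n ∣ p ∪ q ∣ ∣ p ∩ q ∣) (≤-reflexive (∣p∪q∣+∣p∩q∣≡∣p∣+∣q∣ p q))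

module _ {n : ℕ} {x : Fin n} where

  x∉p⇒p⊂p∪⁅x⁆ : ∀ {p} → x ∉ p → p ⊂ p ∪ ⁅ x ⁆
  x∉p⇒p⊂p∪⁅x⁆ {p} x∉p = p⊆p∪q ⁅ x ⁆ , x , q⊆p∪q p ⁅ x ⁆ (x∈⁅x⁆ x) , x∉p

  p⊆q∧x∈q⇒p∪⁅x⁆⊆q : ∀ {p q} → p ⊆ q → x ∈ q → p ∪ ⁅ x ⁆ ⊆ q
  p⊆q∧x∈q⇒p∪⁅x⁆⊆q {p} p⊆q x∈q y∈p∪⁅x⁆ with x∈p∪q⁻ p ⁅ x ⁆ y∈p∪⁅x⁆
  ... | inj₁ y∈p    = p⊆q y∈p
  ... | inj₂ y∈⁅x⁆ rewrite x∈⁅y⁆⇒x≡y x y∈⁅x⁆ = x∈q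

  x∉q⇒[p∪⁅x⁆]∩q⊆p∩q : ∀ p {q} → x ∉ q → (p ∪ ⁅ x ⁆) ∩ q ⊆ p ∩ q
  x∉q⇒[p∪⁅x⁆]∩q⊆p∩q p {q} x∉q y∈ with x∈p∩q⁻ (p ∪ ⁅ x ⁆) q y∈
  ... | y∈p∪⁅x⁆ , y∈q with x∈p∪q⁻ p ⁅ x ⁆ y∈p∪⁅x⁆
  ...   | inj₁ y∈p    = x∈p∩q⁺ (y∈p , y∈q)
  ...   | inj₂ y∈⁅x⁆ rewrite x∈⁅y⁆⇒x≡y x y∈⁅x⁆ = contradiction y∈q x∉q

  ∣[p∪⁅x⁆]∩q∣≤1+∣p∩q∣ : ∀ p q → ∣ (p ∪ ⁅ x ⁆) ∩ q ∣ ≤ suc ∣ p ∩ q ∣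
  ∣[p∪⁅x⁆]∩q∣≤1+∣p∩q∣ p q = begin
    ∣ (p ∪ ⁅ x ⁆) ∩ q ∣       ≡⟨ cong ∣_∣ (∩-distribʳ-∪ q p ⁅ x ⁆) ⟩
    ∣ p ∩ q ∪ ⁅ x ⁆ ∩ q ∣     ≤⟨ ∣p∪q∣≤∣p∣+∣q∣ (p ∩ q) (⁅ x ⁆ ∩ q) ⟩
    ∣ p ∩ q ∣ + ∣ ⁅ x ⁆ ∩ q ∣ ≤⟨ +-monoʳ-≤ ∣ p ∩ q ∣ (∣p∩q∣≤∣p∣ ⁅ x ⁆ q) ⟩
    ∣ p ∩ q ∣ + ∣ ⁅ x ⁆ ∣     ≡⟨ cong (∣ p ∩ q ∣ +_) (∣⁅x⁆∣≡1 x) ⟩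
    ∣ p ∩ q ∣ + 1             ≡⟨ +-comm ∣ p ∩ q ∣ 1 ⟩
    suc ∣ p ∩ q ∣             ∎
    where open Data.Nat.Properties.≤-Reasoning

∃⟶∃-greatest : ∀ {n p} {P : Pred (Fin n) p} → Decidable P → ∃ P →
               ∃ λ i → P i × (∀ j → i Fin.< j → ¬ P j)
∃⟶∃-greatest {suc n} P? (i , Pi) with any? (P? ∘ Fin.suc)
... | yes ∃Psuc with ∃⟶∃-greatest (P? ∘ Fin.suc) ∃Psuc
...   | i′ , Pi′ , greatest = Fin.suc i′ , Pi′ , λ { (Fin.suc j) i′<j → greatest j (s<s⁻¹ i′<j) }
∃⟶∃-greatest {suc n} P? (Fin.zero  , P0) | no ¬∃Psuc =
  Fin.zero , P0 , λ { (Fin.suc j) _ Pj → ¬∃Psuc (j , Pj) }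
∃⟶∃-greatest {suc n} P? (Fin.suc i , Pi) | no ¬∃Psuc = contradiction (i , Pi) ¬∃Psuc

module _ {n : ℕ} (fl : Flag n) where
  open Flag fl

  S-step : (a : Fin (suc r)) (r≢a : r ≢ toℕ a) → S a ⊂ S (Fin.suc (lower₁ a r≢a))
  S-step a r≢a =
    subst (λ b → S b ⊂ S (Fin.suc (lower₁ a r≢a))) (inject₁-lower₁ a r≢a) (strict (lower₁ a r≢a))

  S-ascent : ∀ d {a b} → toℕ a + d ≡ toℕ b → S a ⊆ S b × ∣ S a ∣ + d ≤ ∣ S b ∣
  S-ascent zero {a} {b} a+0≡b with toℕ-injective {i = a} {j = b} (trans (sym (+-identityʳ _)) a+0≡b)
  ... | refl = (λ x∈Sa → x∈Sa) , ≤-reflexive (+-identityʳ _)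
  S-ascent (suc d) {a} {b} a+1+d≡b = ⊆-trans (proj₁ Sa⊂Sa′) (proj₁ ascent′) , size
    where
    a<b : toℕ a < toℕ b
    a<b = ≤-trans (m≤m+n (suc (toℕ a)) d) (≤-reflexive (trans (sym (+-suc (toℕ a) d)) a+1+d≡b))
    r≢a : r ≢ toℕ a
    r≢a = <⇒≢ (≤-trans a<b (toℕ≤pred[n] b)) ∘ sym
    a′ : Fin (suc r)
    a′ = Fin.suc (lower₁ a r≢a)
    Sa⊂Sa′ : S a ⊂ S a′
    Sa⊂Sa′ = S-step a r≢a
    ascent′ : S a′ ⊆ S b × ∣ S a′ ∣ + d ≤ ∣ S b ∣
    ascent′ = S-ascent d (trans (cong (λ m → suc m + d) (toℕ-lower₁ a r≢a))
                                (trans (sym (+-suc (toℕ a) d)) a+1+d≡b))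
    size : ∣ S a ∣ + suc d ≤ ∣ S b ∣
    size = begin
      ∣ S a ∣ + suc d  ≡⟨ +-suc ∣ S a ∣ d ⟩
      suc ∣ S a ∣ + d  ≤⟨ +-monoˡ-≤ d (p⊂q⇒∣p∣<∣q∣ Sa⊂Sa′) ⟩
      ∣ S a′ ∣ + d     ≤⟨ proj₂ ascent′ ⟩
      ∣ S b ∣          ∎
      where open Data.Nat.Properties.≤-Reasoning

  S-mono : ∀ {a b} → toℕ a ≤ toℕ b → S a ⊆ S b
  S-mono a≤b = proj₁ (S-ascent _ (m+[n∸m]≡n a≤b))

  ∣S∣-growth : ∀ {a b} → toℕ a ≤ toℕ b → ∣ S a ∣ + toℕ b ≤ ∣ S b ∣ + toℕ a
  ∣S∣-growth {a} {b} a≤b = begin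
    ∣ S a ∣ + toℕ b        ≡⟨ cong (∣ S a ∣ +_) (trans (sym (m+[n∸m]≡n a≤b)) (+-comm (toℕ a) d)) ⟩
    ∣ S a ∣ + (d + toℕ a)  ≡⟨ sym (+-assoc ∣ S a ∣ d (toℕ a)) ⟩
    ∣ S a ∣ + d + toℕ a    ≤⟨ +-monoˡ-≤ (toℕ a) (proj₂ (S-ascent d (m+[n∸m]≡n a≤b))) ⟩
    ∣ S b ∣ + toℕ a        ∎
    where
    open Data.Nat.Properties.≤-Reasoning
    d = toℕ b ∸ toℕ a

  SlackAbove : Subset n → Fin (suc r) → Set
  SlackAbove I j = ∀ a → j Fin.< a → ∣ I ∩ S a ∣ < toℕ a

  greatest-tight : ∀ I → Independent fl I → ∃ λ j → ∣ I ∩ S j ∣ ≡ toℕ j × SlackAbove I j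
  greatest-tight I indI
    with ∃⟶∃-greatest (λ a → ∣ I ∩ S a ∣ ≟ℕ toℕ a) (Fin.zero , n≤0⇒n≡0 (indI Fin.zero))
  ... | j , tight , greatest = j , tight , λ a j<a → ≤∧≢⇒< (indI a) (greatest a j<a)

  augment : ∀ I {j x} → Independent fl I → SlackAbove I j → x ∉ S j → Independent fl (I ∪ ⁅ x ⁆)
  augment I {j} {x} indI slack x∉Sj a with toℕ a ≤? toℕ j
  ... | yes a≤j = ≤-trans (p⊆q⇒∣p∣≤∣q∣ (x∉q⇒[p∪⁅x⁆]∩q⊆p∩q I (x∉Sj ∘ S-mono a≤j))) (indI a)
  ... | no  a≰j = ≤-trans (∣[p∪⁅x⁆]∩q∣≤1+∣p∩q∣ I (S a)) (slack a (≰⇒> a≰j))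

  maximum-covers : ∀ {F} I {j} → I ⊆ F → Independent fl I →
                   (∀ J → J ⊆ F → Independent fl J → ∣ J ∣ ≤ ∣ I ∣) →
                   SlackAbove I j → F ⊆ I ∪ S j
  maximum-covers {F} I {j} I⊆F indI maximum slack {x} x∈F with x ∈? I | x ∈? S j
  ... | yes x∈I | _        = p⊆p∪q (S j) x∈I
  ... | no  _   | yes x∈Sj = q⊆p∪q I (S j) x∈Sj
  ... | no  x∉I | no  x∉Sj =
    contradiction (maximum (I ∪ ⁅ x ⁆) (p⊆q∧x∈q⇒p∪⁅x⁆⊆q I⊆F x∈F) (augment I indI slack x∉Sj))
                  (<⇒≱ (p⊂q⇒∣p∣<∣q∣ (x∉p⇒p⊂p∪⁅x⁆ x∉I)))

  ∣X∣≤∣S[rank]∣ : ∀ {X k} → HasRank fl X k → (k<1+r : k < suc r) → ∣ X ∣ ≤ ∣ S (fromℕ< k<1+r) ∣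
  ∣X∣≤∣S[rank]∣ {X} {k} ((I , I⊆X , indI , ∣I∣≡k) , rank≤k) k<1+r with greatest-tight I indI
  ... | j , tight , slack = +-cancelʳ-≤ (toℕ j) ∣ X ∣ ∣ S K ∣ (begin
    ∣ X ∣ + toℕ j                ≤⟨ +-monoˡ-≤ (toℕ j) (p⊆q⇒∣p∣≤∣q∣ X⊆I∪Sj) ⟩
    ∣ I ∪ S j ∣ + toℕ j          ≡⟨ cong (∣ I ∪ S j ∣ +_) (sym tight) ⟩
    ∣ I ∪ S j ∣ + ∣ I ∩ S j ∣    ≡⟨ ∣p∪q∣+∣p∩q∣≡∣p∣+∣q∣ I (S j) ⟩
    ∣ I ∣ + ∣ S j ∣              ≡⟨ +-comm ∣ I ∣ ∣ S j ∣ ⟩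
    ∣ S j ∣ + ∣ I ∣              ≡⟨ cong (∣ S j ∣ +_) ∣I∣≡K ⟩
    ∣ S j ∣ + toℕ K              ≤⟨ ∣S∣-growth j≤K ⟩
    ∣ S K ∣ + toℕ j              ∎)
    where
    open Data.Nat.Properties.≤-Reasoning
    K : Fin (suc r)
    K = fromℕ< k<1+r
    ∣I∣≡K : ∣ I ∣ ≡ toℕ K
    ∣I∣≡K = trans ∣I∣≡k (sym (toℕ-fromℕ< k<1+r))
    X⊆I∪Sj : X ⊆ I ∪ S j
    X⊆I∪Sj = maximum-covers I I⊆X indI
               (λ J J⊆X indJ → subst (∣ J ∣ ≤_) (sym ∣I∣≡k) (rank≤k J J⊆X indJ)) slack
    j≤K : toℕ j ≤ toℕ K
    j≤K = subst₂ _≤_ tight ∣I∣≡K (∣p∩q∣≤∣p∣ I (S j))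

corollary5p6 : {n : ℕ} (fl : Flag n) (F : Subset n) (k : ℕ)
    → IsFlat fl F → HasRank fl F k
    → (k≤r : k < suc (Flag.r fl))
    → ∣ F ∣ ≤ ∣ Flag.S fl (fromℕ< k≤r) ∣
corollary5p6 fl F k _ = ∣X∣≤∣S[rank]∣ fl
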